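{- Let $\mathcal{A}=(\Sigma,\mathbb{R}_+,d,\mu,\lambda)$ be a positive multiplicity tree automaton over a skeletal alphabet $\Sigma=(\Sigma_0,\Sigma_1,\ldots,\Sigma_p)$, and let $\mathcal{W}$ be the weighted grammar $\mathcal{W}_{\mathcal{A}}$ constructed from $\mathcal{A}$ as described in the context. Then $\mathcal{W}(t)=\mathcal{A}(t)$ for every skeletal tree $t\in\mathrm{Trees}(\Sigma)$.
   Context: A skeletal alphabet: $\Sigma_0$ is a finite nonempty set of terminals and for $1\le k\le p$, $\Sigma_k=\{?\}$ (one symbol of rank $k$). Skeletal trees are trees over it (internal nodes labelled ?, leaves in $\Sigma_0$). A multiplicity tree automaton $(\Sigma,\mathbb{K},d,\mu,\lambda)$ has $\lambda\in\mathbb{K}^d$ and for every $\sigma\in\Sigma_k$ a $k$-linear map $\mu_\sigma:(\mathbb{K}^d)^k\to\mathbb{K}^d$ with coefficients $c^i_{j_1\ldots j_k}$, i.e. $\mu_\sigma(x_1,\ldots,x_k)[i]=\sum_{(j_1,\ldots,j_k)\in\{1..d\}^k}c^i_{j_1\ldots j_k}x_1[j_1]\cdots x_k[j_k]$ (for $\sigma\in\Sigma_0$, $\mu_\sigma\in\mathbb{K}^d$); $\mu(\sigma(t_1,\ldots,t_k))=\mu_\sigma(\mu(t_1),\ldots,\mu(t_k))$ and $\mathcal{A}(t)=\lambda\cdot\mu(t)$. It is positive if all entries of $\lambda$ and all coefficients are nonnegative. Construction of $\mathcal{W}_{\mathcal{A}}=(G,\theta)$, $G=(\mathcal{V},\Sigma_0,R,S)$: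 $\mathcal{V}=\{S\}\cup\{V_1,\ldots,V_d\}$; rules $S\to V_i$ with $\theta=\lambda[i]$; $V_i\to\sigma$ for $\sigma\in\Sigma_0$ with $\theta=\mu_\sigma[i]$; $V_i\to V_{i_1}\cdots V_{i_k}$ for $1\le k\le p$, $1\le i,i_1,\ldots,i_k\le d$, with $\theta=c^i_{i_1\ldots i_k}$ the coefficient of $\mu_?$ for $?\in\Sigma_k$. The weight of a derivation tree is the product of the weights of the rules used (with multiplicity). For a variable $V_i$ and a skeletal tree $s$, $\mathcal{W}_{V_i}(s)$ is the sum of weights of derivation trees rooted at $V_i$ whose skeleton is $s$, where the skeleton of a derivation tree is obtained by turning each node labelled $V_j$ that uses a rule $V_j\to\sigma$ into the leaf $\sigma$ and relabelling every other variable node by ?. Finally $\mathcal{W}(t)=\sum_{i=1}^d\theta(S\to V_i)\,\mathcal{W}_{V_i}(t)$, i.e. the total weight of derivations $S\Rightarrow V_i\Rightarrow^*$ whose part below $V_i$ has skeleton $t$. -}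

module Defs where

open import Data.Nat using (ℕ; zero; suc)
open import Data.Fin using (Fin; toℕ)
open import Data.Vec using (Vec; []; _∷_)
open import Data.List using (List; []; _∷_; map; concatMap; foldr; allFin)
open import Data.List.Membership.Propositional using (_∈_)
open import Data.List.Relation.Unary.Unique.Propositional using (Unique)
open import Data.Product using (_×_)
open import Relation.Binary.PropositionalEquality using (_≡_)
open import Algebra.Bundles using (CommutativeSemiring)

-- Skeletal alphabet with parameters m and p:
--   Σ₀ = Fin (suc m)   (finite, nonempty set of terminals)
--   Σ_k = {?} for 1 ≤ k ≤ p; the unique symbol of rank k is indexed by
--   k' : Fin p with k = arity k' = suc (toℕ k').

arity : {p : ℕ} → Fin p → ℕ
arity k = suc (toℕ k)

data Tree (m p : ℕ) : Set where
  leaf : Fin (suc m) → Tree m p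
  node : (k : Fin p) → Vec (Tree m p) (arity k) → Tree m p

allTuples : (d n : ℕ) → List (Vec (Fin d) n)
allTuples d zero    = [] ∷ []
allTuples d (suc n) = concatMap (λ j → map (j ∷_) (allTuples d n)) (allFin d)

data Var (d : ℕ) : Set where
  S : Var d
  V : Fin d → Var d

data Rule (m p d : ℕ) : Set where
  startR : Fin d → Rule m p d                      -- S → V_i
  termR  : Fin d → Fin (suc m) → Rule m p d        -- V_i → σ
  prodR  : Fin d → (k : Fin p) → Vec (Fin d) (arity k) → Rule m p d
                                                   -- V_i → V_{i₁} ⋯ V_{i_k}

-- Derivation trees rooted at V_i (below S)
mutual
  data Deriv (m p d : ℕ) : Fin d → Set where
    byTerm : (i : Fin d) (σ : Fin (suc m)) → Deriv m p d i
    byProd : (i : Fin d) (k : Fin p) (js : Vec (Fin d) (arity k)) →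
             Derivs m p d js → Deriv m p d i

  data Derivs (m p d : ℕ) : {n : ℕ} → Vec (Fin d) n → Set where
    []  : Derivs m p d []
    _∷_ : {n : ℕ} {j : Fin d} {js : Vec (Fin d) n} →
          Deriv m p d j → Derivs m p d js → Derivs m p d (j ∷ js)

rootRule : {m p d : ℕ} {i : Fin d} → Deriv m p d i → Rule m p d
rootRule (byTerm i σ)        = termR i σ
rootRule (byProd i k js _)   = prodR i k js

mutual
  skeleton : {m p d : ℕ} {i : Fin d} → Deriv m p d i → Tree m p
  skeleton (byTerm i σ)       = leaf σ
  skeleton (byProd i k js ds) = node k (skeletons ds)

  skeletons : {m p d n : ℕ} {js : Vec (Fin d) n} → Derivs m p d js → Vec (Tree m p) n
  skeletons []       = []
  skeletons (D ∷ ds) = skeleton D ∷ skeletons ds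

IsSkeletonEnum : {m p d : ℕ} (t : Tree m p) (i : Fin d) → List (Deriv m p d i) → Set
IsSkeletonEnum t i L =
  Unique L ×
  ((D : _) → skeleton D ≡ t → D ∈ L) ×
  ((D : _) → D ∈ L → skeleton D ≡ t)

module Weighted {c ℓ} (K : CommutativeSemiring c ℓ) where
  open CommutativeSemiring K

  sumL : List Carrier → Carrier
  sumL = foldr _+_ 0#

  prodV : {n : ℕ} → Vec Carrier n → Carrier
  prodV []       = 1#
  prodV (x ∷ xs) = x * prodV xs

  sumFin : {d : ℕ} → (Fin d → Carrier) → Carrier
  sumFin {d} f = sumL (map f (allFin d))

  record MTA (m p d : ℕ) : Set c where
    field
      lam  : Fin d → Carrier
      mu0  : Fin (suc m) → Fin d → Carrier
      coef : (k : Fin p) → Fin d → Vec (Fin d) (arity k) → Carrier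
                                                   -- c^i_{j₁…j_k} of μ_? , ? ∈ Σ_k

  module _ {m p d : ℕ} (A : MTA m p d) where
    open MTA A

    zipApply : {n : ℕ} → Vec (Fin d → Carrier) n → Vec (Fin d) n → Vec Carrier n
    zipApply []       []       = []
    zipApply (x ∷ xs) (j ∷ js) = x j ∷ zipApply xs js

    muNode : (k : Fin p) → Vec (Fin d → Carrier) (arity k) → Fin d → Carrier
    muNode k xs i =
      sumL (map (λ js → coef k i js * prodV (zipApply xs js)) (allTuples d (arity k)))

    mutual
      mu : Tree m p → Fin d → Carrier
      mu (leaf σ)    = mu0 σ
      mu (node k ts) = muNode k (mus ts)

      mus : {n : ℕ} → Vec (Tree m p) n → Vec (Fin d → Carrier) n
      mus []       = []
      mus (t ∷ ts) = mu t ∷ mus ts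

    evalA : Tree m p → Carrier
    evalA t = sumFin (λ i → lam i * mu t i)

    θ : Rule m p d → Carrier
    θ (startR i)      = lam i
    θ (termR i σ)     = mu0 σ i
    θ (prodR i k js)  = coef k i js

    mutual
      weight : {i : Fin d} → Deriv m p d i → Carrier
      weight (byTerm i σ)       = θ (termR i σ)
      weight (byProd i k js ds) = θ (prodR i k js) * weights ds

      weights : {n : ℕ} {js : Vec (Fin d) n} → Derivs m p d js → Carrier
      weights []       = 1#
      weights (D ∷ ds) = weight D * weights ds

    W_V : {i : Fin d} → List (Deriv m p d i) → Carrier
    W_V L = sumL (map weight L)

    W : ((i : Fin d) → List (Deriv m p d i)) → Carrier
    W L = sumFin (λ i → θ (startR i) * W_V (L i))

-- The derivations rooted at V_i with skeleton t are enumerated canonically by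
-- recursion on t: for t = ?(t₁,…,t_k), one rule V_i → V_{j₁}⋯V_{j_k} per tuple
-- (j₁,…,j_k), followed by every tuple of derivations of t₁,…,t_k rooted at
-- V_{j₁},…,V_{j_k}. Any enumeration L i as in the hypothesis is a permutation of
-- this one. Summing weights over it, distributivity factors the sum over tuples
-- of derivations into Π_r (sum over derivations of t_r), so by induction the sum
-- is Σ_js c^i_js μ(t₁)[j₁]⋯μ(t_k)[j_k] = μ(t)[i]; weighting by λ gives A(t).
module Submission where

open import Defs
open import Data.Nat using (ℕ; suc)
open import Data.Fin using (Fin)
open import Data.Vec using (Vec; []; _∷_)
open import Data.List using (List; []; _∷_; map; concatMap; allFin; _++_)
open import Data.List.Properties using (map-++; map-∘)
open import Data.List.Membership.Propositional using (_∈_; find; lose)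
open import Data.List.Membership.Propositional.Properties
  using (∈-map⁺; ∈-map⁻; ∈-concatMap⁺; ∈-concatMap⁻; ∈-allFin)
open import Data.List.Membership.Propositional.Properties.WithK using (unique∧set⇒bag)
open import Data.List.Relation.Unary.Any using (here)
import Data.List.Relation.Unary.All as All
import Data.List.Relation.Unary.All.Properties as All
import Data.List.Relation.Unary.AllPairs as AllPairs
import Data.List.Relation.Unary.AllPairs.Properties as AllPairs
open import Data.List.Relation.Unary.Unique.Propositional using (Unique)
import Data.List.Relation.Unary.Unique.Propositional.Properties as Unique
open import Data.List.Relation.Binary.Permutation.Propositional using (_↭_; ↭⇒↭ₛ′)
import Data.List.Relation.Binary.Permutation.Propositional.Properties as ↭
import Data.List.Relation.Binary.Permutation.Setoid.Properties as ↭ₛ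
open import Data.List.Relation.Binary.Disjoint.Propositional using (Disjoint)
open import Data.List.Relation.Binary.BagAndSetEquality using (∼bag⇒↭)
open import Data.Product using (_×_; _,_; ∃₂)
open import Function using (_∘_)
open import Function.Bundles using (mk⇔)
open import Level using (Level)
open import Relation.Binary.PropositionalEquality using (_≡_; _≢_; refl; cong; cong₂; subst)
open import Algebra.Bundles using (CommutativeSemiring)
import Relation.Binary.Reasoning.Setoid as SetoidReasoning

private
  variable
    a b c : Level

dependentProductWith : {A : Set a} {B : A → Set b} {C : Set c} →
                       ((x : A) → B x → C) → List A → ((x : A) → List (B x)) → List C
dependentProductWith g xs ys = concatMap (λ x → map (g x) (ys x)) xs

module _ {A : Set a} {B : A → Set b} {C : Set c} {g : (x : A) → B x → C} where

  ∈-dependentProductWith⁺ : {xs : List A} {ys : (x : A) → List (B x)} {x : A} {u : B x} →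
                            x ∈ xs → u ∈ ys x → g x u ∈ dependentProductWith g xs ys
  ∈-dependentProductWith⁺ {ys = ys} x∈xs u∈ys =
    ∈-concatMap⁺ (λ x → map (g x) (ys x)) (lose x∈xs (∈-map⁺ (g _) u∈ys))

  ∈-dependentProductWith⁻ : (xs : List A) (ys : (x : A) → List (B x)) {v : C} →
                            v ∈ dependentProductWith g xs ys →
                            ∃₂ λ x u → x ∈ xs × u ∈ ys x × v ≡ g x u
  ∈-dependentProductWith⁻ xs ys v∈ with find (∈-concatMap⁻ (λ x → map (g x) (ys x)) {xs} v∈)
  ... | x , x∈xs , v∈map with ∈-map⁻ (g x) v∈map
  ...   | u , u∈ys , v≡gxu = x , u , x∈xs , u∈ys , v≡gxu

  Unique-dependentProductWith⁺ : (∀ {x x′ u u′} → g x u ≡ g x′ u′ → x ≡ x′) →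
                                 (∀ {x u u′} → g x u ≡ g x u′ → u ≡ u′) →
                                 {xs : List A} {ys : (x : A) → List (B x)} →
                                 Unique xs → (∀ x → Unique (ys x)) →
                                 Unique (dependentProductWith g xs ys)
  Unique-dependentProductWith⁺ g-tagged g-injective {xs} {ys} xs! ys! =
    Unique.concat⁺ (All.map⁺ (All.universal (λ x → Unique.map⁺ g-injective (ys! x)) xs))
                   (AllPairs.map⁺ (AllPairs.map fibres-disjoint xs!))
    where
    fibres-disjoint : ∀ {x x′} → x ≢ x′ → Disjoint (map (g x) (ys x)) (map (g x′) (ys x′))
    fibres-disjoint x≢x′ (v∈ , v∈′) with ∈-map⁻ (g _) v∈ | ∈-map⁻ (g _) v∈′
    ... | _ , _ , refl | _ , _ , gxu≡gx′u′ = x≢x′ (g-tagged gxu≡gx′u′)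

-- allTuples d (suc n) unfolds to dependentProductWith _∷_ (allFin d) (λ _ → allTuples d n).
allTuples-complete : ∀ {d n} (js : Vec (Fin d) n) → js ∈ allTuples d n
allTuples-complete []       = here refl
allTuples-complete (j ∷ js) = ∈-dependentProductWith⁺ (∈-allFin j) (allTuples-complete js)

allTuples-unique : ∀ d n → Unique (allTuples d n)
allTuples-unique d 0       = All.[] AllPairs.∷ AllPairs.[]
allTuples-unique d (suc n) =
  Unique-dependentProductWith⁺ (λ { refl → refl }) (λ { refl → refl })
    (Unique.allFin⁺ d) (λ _ → allTuples-unique d n)

module Sums {r ℓ} (K : CommutativeSemiring r ℓ) where
  open CommutativeSemiring K renaming (refl to ≈-refl)
  open Weighted K using (sumL)
  open SetoidReasoning setoid

  ∑ : {X : Set a} → List X → (X → Carrier) → Carrier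
  ∑ xs f = sumL (map f xs)

  sumL-++ : (xs ys : List Carrier) → sumL (xs ++ ys) ≈ sumL xs + sumL ys
  sumL-++ []       ys = sym (+-identityˡ _)
  sumL-++ (x ∷ xs) ys = begin
    x + sumL (xs ++ ys)       ≈⟨ +-congˡ (sumL-++ xs ys) ⟩
    x + (sumL xs + sumL ys)   ≈⟨ sym (+-assoc x _ _) ⟩
    x + sumL xs + sumL ys     ∎

  sumL-↭ : {xs ys : List Carrier} → xs ↭ ys → sumL xs ≈ sumL ys
  sumL-↭ = ↭ₛ.foldr-commMonoid setoid +-isCommutativeMonoid ∘ ↭⇒↭ₛ′ isEquivalence

  module _ {X : Set a} where

    ∑-cong : (xs : List X) {f g : X → Carrier} → (∀ x → f x ≈ g x) → ∑ xs f ≈ ∑ xs g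
    ∑-cong []       f≈g = ≈-refl
    ∑-cong (x ∷ xs) f≈g = +-cong (f≈g x) (∑-cong xs f≈g)

    ∑-*ˡ : (xs : List X) (k : Carrier) (f : X → Carrier) → ∑ xs (λ x → k * f x) ≈ k * ∑ xs f
    ∑-*ˡ []       k f = sym (zeroʳ k)
    ∑-*ˡ (x ∷ xs) k f = trans (+-congˡ (∑-*ˡ xs k f)) (sym (distribˡ k _ _))

    ∑-*ʳ : (xs : List X) (k : Carrier) (f : X → Carrier) → ∑ xs (λ x → f x * k) ≈ ∑ xs f * k
    ∑-*ʳ []       k f = sym (zeroˡ k)
    ∑-*ʳ (x ∷ xs) k f = trans (+-congˡ (∑-*ʳ xs k f)) (sym (distribʳ k _ _))

  module _ {A : Set a} {B : A → Set b} {C : Set c} where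

    ∑-dependentProductWith : (g : (x : A) → B x → C) (xs : List A) (ys : (x : A) → List (B x))
                             (h : C → Carrier) →
                             ∑ (dependentProductWith g xs ys) h ≈ ∑ xs (λ x → ∑ (ys x) (h ∘ g x))
    ∑-dependentProductWith g []       ys h = ≈-refl
    ∑-dependentProductWith g (x ∷ xs) ys h = begin
      sumL (map h (map (g x) (ys x) ++ rest))         ≡⟨ cong sumL (map-++ h (map (g x) (ys x)) rest) ⟩
      sumL (map h (map (g x) (ys x)) ++ map h rest)   ≈⟨ sumL-++ (map h (map (g x) (ys x))) (map h rest) ⟩
      sumL (map h (map (g x) (ys x))) + ∑ rest h      ≡⟨ cong (λ s → sumL s + ∑ rest h) (map-∘ (ys x)) ⟨
      ∑ (ys x) (h ∘ g x) + ∑ rest h                   ≈⟨ +-congˡ (∑-dependentProductWith g xs ys h) ⟩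
      ∑ (ys x) (h ∘ g x) + ∑ xs (λ x → ∑ (ys x) (h ∘ g x)) ∎
      where rest = dependentProductWith g xs ys

module Derivations {r ℓ} (K : CommutativeSemiring r ℓ) {m p d : ℕ} (A : Weighted.MTA K m p d) where
  open CommutativeSemiring K hiding (refl)
  open Weighted K
  open MTA A
  open Sums K
  open SetoidReasoning setoid

  mutual
    derivations : Tree m p → (i : Fin d) → List (Deriv m p d i)
    derivations (leaf σ)    i = byTerm i σ ∷ []
    derivations (node k ts) i =
      dependentProductWith (byProd i k) (allTuples d (arity k)) (derivationTuples ts)

    derivationTuples : ∀ {n} → Vec (Tree m p) n → (js : Vec (Fin d) n) → List (Derivs m p d js)
    derivationTuples []       []       = [] ∷ []
    derivationTuples (t ∷ ts) (j ∷ js) =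
      dependentProductWith _∷_ (derivations t j) (λ _ → derivationTuples ts js)

  mutual
    ∑-weight-derivations : (t : Tree m p) (i : Fin d) → ∑ (derivations t i) (weight A) ≈ mu A t i
    ∑-weight-derivations (leaf σ)    i = +-identityʳ _
    ∑-weight-derivations (node k ts) i = begin
      ∑ (derivations (node k ts) i) (weight A)
        ≈⟨ ∑-dependentProductWith (byProd i k) tuples (derivationTuples ts) (weight A) ⟩
      ∑ tuples (λ js → ∑ (derivationTuples ts js) (λ ds → coef k i js * weights A ds))
        ≈⟨ ∑-cong tuples (λ js → ∑-*ˡ (derivationTuples ts js) (coef k i js) (weights A)) ⟩
      ∑ tuples (λ js → coef k i js * ∑ (derivationTuples ts js) (weights A))
        ≈⟨ ∑-cong tuples (λ js → *-congˡ (∑-weights-derivationTuples ts js)) ⟩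
      muNode A k (mus A ts) i ∎
      where tuples = allTuples d (arity k)

    ∑-weights-derivationTuples : ∀ {n} (ts : Vec (Tree m p) n) (js : Vec (Fin d) n) →
                                 ∑ (derivationTuples ts js) (weights A) ≈ prodV (zipApply A (mus A ts) js)
    ∑-weights-derivationTuples []       []       = +-identityʳ _
    ∑-weights-derivationTuples (t ∷ ts) (j ∷ js) = begin
      ∑ (derivationTuples (t ∷ ts) (j ∷ js)) (weights A)
        ≈⟨ ∑-dependentProductWith _∷_ (derivations t j) (λ _ → rest) (weights A) ⟩
      ∑ (derivations t j) (λ D → ∑ rest (λ ds → weight A D * weights A ds))
        ≈⟨ ∑-cong (derivations t j) (λ D → ∑-*ˡ rest (weight A D) (weights A)) ⟩
      ∑ (derivations t j) (λ D → weight A D * ∑ rest (weights A))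
        ≈⟨ ∑-*ʳ (derivations t j) (∑ rest (weights A)) (weight A) ⟩
      ∑ (derivations t j) (weight A) * ∑ rest (weights A)
        ≈⟨ *-cong (∑-weight-derivations t j) (∑-weights-derivationTuples ts js) ⟩
      mu A t j * prodV (zipApply A (mus A ts) js) ∎
      where rest = derivationTuples ts js

  mutual
    derivations-complete : ∀ {i} (D : Deriv m p d i) → D ∈ derivations (skeleton D) i
    derivations-complete (byTerm i σ)       = here refl
    derivations-complete (byProd i k js ds) =
      ∈-dependentProductWith⁺ (allTuples-complete js) (derivationTuples-complete ds)

    derivationTuples-complete : ∀ {n} {js : Vec (Fin d) n} (ds : Derivs m p d js) →
                                ds ∈ derivationTuples (skeletons ds) js
    derivationTuples-complete []       = here refl
    derivationTuples-complete (D ∷ ds) =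
      ∈-dependentProductWith⁺ (derivations-complete D) (derivationTuples-complete ds)

  mutual
    derivations-sound : ∀ t i {D : Deriv m p d i} → D ∈ derivations t i → skeleton D ≡ t
    derivations-sound (leaf σ) i (here refl) = refl
    derivations-sound (node k ts) i D∈
      with ∈-dependentProductWith⁻ (allTuples d (arity k)) (derivationTuples ts) D∈
    ... | js , ds , _ , ds∈ , refl = cong (node k) (derivationTuples-sound ts js ds∈)

    derivationTuples-sound : ∀ {n} (ts : Vec (Tree m p) n) js {ds : Derivs m p d js} →
                             ds ∈ derivationTuples ts js → skeletons ds ≡ ts
    derivationTuples-sound []       []       (here refl) = refl
    derivationTuples-sound (t ∷ ts) (j ∷ js) ds∈
      with ∈-dependentProductWith⁻ (derivations t j) (λ _ → derivationTuples ts js) ds∈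
    ... | D , ds , D∈ , ds∈ , refl =
      cong₂ _∷_ (derivations-sound t j D∈) (derivationTuples-sound ts js ds∈)

  mutual
    derivations-unique : ∀ t i → Unique (derivations t i)
    derivations-unique (leaf σ)    i = All.[] AllPairs.∷ AllPairs.[]
    derivations-unique (node k ts) i =
      Unique-dependentProductWith⁺ (λ { refl → refl }) (λ { refl → refl })
        (allTuples-unique d (arity k)) (derivationTuples-unique ts)

    derivationTuples-unique : ∀ {n} (ts : Vec (Tree m p) n) js → Unique (derivationTuples ts js)
    derivationTuples-unique []       []       = All.[] AllPairs.∷ AllPairs.[]
    derivationTuples-unique (t ∷ ts) (j ∷ js) =
      Unique-dependentProductWith⁺ (λ { refl → refl }) (λ { refl → refl })
        (derivations-unique t j) (λ _ → derivationTuples-unique ts js)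

  skeletonEnum↭derivations : ∀ {t i L} → IsSkeletonEnum t i L → L ↭ derivations t i
  skeletonEnum↭derivations {t} {i} (L! , complete , sound) =
    ∼bag⇒↭ (unique∧set⇒bag L! (derivations-unique t i) (mk⇔
      (λ D∈L → subst (λ s → _ ∈ derivations s i) (sound _ D∈L) (derivations-complete _))
      (λ D∈ → complete _ (derivations-sound t i D∈))))

  skeletonEnum-weight≈mu : ∀ {t i L} → IsSkeletonEnum t i L → W_V A L ≈ mu A t i
  skeletonEnum-weight≈mu {t} {i} {L} L-enum = begin
    W_V A L                        ≈⟨ sumL-↭ (↭.map⁺ (weight A) (skeletonEnum↭derivations L-enum)) ⟩
    ∑ (derivations t i) (weight A) ≈⟨ ∑-weight-derivations t i ⟩
    mu A t i                       ∎

proposition3p2 : ∀ {c ℓ} (K : CommutativeSemiring c ℓ) (m p d : ℕ)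
    (A : Weighted.MTA K m p d) (t : Tree m p)
    (L : (i : Fin d) → List (Deriv m p d i)) →
    ((i : Fin d) → IsSkeletonEnum t i (L i)) →
    CommutativeSemiring._≈_ K (Weighted.W K A L) (Weighted.evalA K A t)
proposition3p2 K m p d A t L L-enum =
  ∑-cong (allFin d) (λ i → *-congˡ (skeletonEnum-weight≈mu (L-enum i)))
  where
  open CommutativeSemiring K using (*-congˡ)
  open Sums K using (∑-cong)
  open Derivations K A using (skeletonEnum-weight≈mu)
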